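{- Let $n\ge 3$ be a prime and let $G$ be the graph defined in the context below. Then $G$ is bipartite and \[\chi_\ell(G^2)-\chi(G^2) > n^2-6n+3.\]
   Context: For a graph $H$, $H^2$ denotes the square of $H$: the graph on $V(H)$ in which two distinct vertices are adjacent iff their distance in $H$ is at most $2$. $\chi$ denotes the chromatic number and $\chi_\ell$ the list chromatic number (choice number). Write $[n]=\{1,\dots,n\}$. For $i\in[n-1]$ define $L_i(j,k)\in[n]$ for $j,k\in[n]$ by $L_i(j,k)\equiv j+i(k-1)\pmod n$ (the residue $0$ being represented by $n$). The graph $G$ has vertex set consisting of: vertices $v^l_{k,j}$ for $k,l,j\in[n]$; vertices $w_{i,j}$ and $u_{i,j}$ for $i\in[n-1]$, $j\in[n]$; and vertices $s_m$ for $m\in[n]$ (all distinct), so $|V(G)|=n(n^2+2n-1)$. For $l,m\in[n]$ let $T_{l,m}=\{v^l_{1,m},v^l_{2,m},\dots,v^l_{n,m}\}$. The edges of $G$ are exactly: - $w_{i,j}v^l_{k,L_i(j,k)}$ for all $i\in[n-1]$, $j,k,l\in[n]$; - $u_{i,j}y$ for all $i\in[n-1]$, $j\in[n]$ and all $y\in T_{l,L_i(j,l)}$ for some $l\in[n]$ (so $N_G(u_{i,j})=\bigcup_{l\in[n]}T_{l,L_i(j,l)}$); - $s_m y$ for all $m\in[n]$ and all $y\in T_{l,m}$ for some $l\in[n]$ (so $N_G(s_m)=\bigcup_{l\in[n]}T_{l,m}$). -}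

module Defs where

open import Data.Nat using (ℕ; zero; suc; _+_; _*_; _∸_; _≤_; NonZero)
open import Data.Nat.Base using (_%_)
open import Data.Fin using (Fin; toℕ)
open import Data.Product using (Σ; _×_; Σ-syntax)
open import Data.Sum using (_⊎_)
open import Data.List using (List; length)
open import Data.List.Membership.Propositional using (_∈_)
open import Data.List.Relation.Unary.Unique.Propositional using (Unique)
open import Relation.Binary.PropositionalEquality using (_≡_; _≢_)

-- Indexing convention: all indices are 0-based Fin values.
--   j, k, l, m ∈ [n]    are represented by  Fin n    (value = toℕ + 1)
--   i ∈ [n-1]           is represented by  Fin (n ∸ 1) (value = toℕ i + 1)
data V (n : ℕ) : Set where
  v : (l k j : Fin n) → V n
  w : (i : Fin (n ∸ 1)) (j : Fin n) → V n
  u : (i : Fin (n ∸ 1)) (j : Fin n) → V n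
  s : (m : Fin n) → V n

-- 0-based version of L_i(j,k): L_i(j,k) - 1 = (j + i(k-1)) mod n with 1-based j,k,i;
-- in 0-based j', k' (j = j'+1, k = k'+1) and actual i = toℕ i' + 1 this is
-- (j' + i k') mod n ∈ {0,…,n-1}.
L0 : (n : ℕ) .{{_ : NonZero n}} → Fin (n ∸ 1) → Fin n → Fin n → ℕ
L0 n i j k = (toℕ j + suc (toℕ i) * toℕ k) % n

-- The edges of G (each listed once, oriented from w/u/s to v).
data Edge (n : ℕ) .{{_ : NonZero n}} : V n → V n → Set where
  ew : ∀ i j l k m → toℕ m ≡ L0 n i j k → Edge n (w i j) (v l k m)
  -- u_{i,j} y for y ∈ T_{l,L_i(j,l)} = { v^l_{k,L_i(j,l)} : k }
  eu : ∀ i j l k m → toℕ m ≡ L0 n i j l → Edge n (u i j) (v l k m)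
  es : ∀ m l k → Edge n (s m) (v l k m)

Graph : Set → Set₁
Graph A = A → A → Set

G : (n : ℕ) .{{_ : NonZero n}} → Graph (V n)
G n x y = Edge n x y ⊎ Edge n y x

Square : {A : Set} → Graph A → Graph A
Square E x y = x ≢ y × (E x y ⊎ Σ[ z ∈ _ ] (E x z × E z y))

Proper : {A C : Set} → Graph A → (A → C) → Set
Proper E c = ∀ x y → E x y → c x ≢ c y

Colorable : {A : Set} → Graph A → ℕ → Set
Colorable {A} E k = Σ[ c ∈ (A → Fin k) ] Proper E c

Bipartite : {A : Set} → Graph A → Set
Bipartite E = Colorable E 2

Choosable : {A : Set} → Graph A → ℕ → Set
Choosable {A} E k =
  (Lst : A → List ℕ) → (∀ x → length (Lst x) ≡ k) → (∀ x → Unique (Lst x)) →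
  Σ[ c ∈ (A → ℕ) ] ((∀ x → c x ∈ Lst x) × Proper E c)

IsChromaticNumber : {A : Set} → Graph A → ℕ → Set
IsChromaticNumber E k = Colorable E k × (∀ j → Colorable E j → k ≤ j)

IsChoiceNumber : {A : Set} → Graph A → ℕ → Set
IsChoiceNumber E k = Choosable E k × (∀ j → Choosable E j → k ≤ j)

module Submission where

-- Every edge of G joins a v to a w, u or s, so G is bipartite.  In G², colour v^l_{k,j} by
-- (l, k), w_{i,j} by i, u_{i,j} by i (from a second palette) and every s_m alike: equally
-- coloured vertices are never at distance ≤ 2, since a w, u or s has exactly one neighbour in
-- each column {v^l_{k,j} : j}, while w_{i,j} and w_{i,j′} (likewise u_{i,·}, s_·) have no
-- common neighbour for j ≠ j′.  Hence χ(G²) ≤ n² + 2n − 1.  As n is prime, for j ≠ j′ and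
-- a ≠ a′ the congruences j ≡ x + i a, j′ ≡ x + i a′ (mod n) have a solution with i ≢ 0, so
-- any two v's in different columns have a common neighbour and the v's induce in G² a
-- complete n²-partite graph with parts of size n.  Split n(2n − 1) colours into n blocks of
-- size 2n − 1 and give v^l_{k,j} the colours outside block j: if v^l_{k,1} receives a colour
-- of block j, then v^l_{k,j} receives another one, so the n² columns need 2n² > n(2n − 1)
-- colours.  Hence χ_ℓ(G²) > (n − 1)(2n − 1) and χ_ℓ(G²) − χ(G²) ≥ n² − 5n + 3.

open import Data.Nat
  using (ℕ; zero; suc; _+_; _*_; _∸_; _≤_; _<_; NonZero; >-nonZero⁻¹; pred; _⊓_; z≤n; s≤s; _%_)
open import Data.Nat.Properties
  using ( +-comm; +-assoc; +-identityʳ; *-comm; *-assoc; *-identityʳ; *-distribˡ-+; *-distribʳ-+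
        ; +-commutativeSemigroup; suc-pred; ∸-monoˡ-<; m≤n⇒m⊓n≡m; n<1+n; m≤m+n; ≤-reflexive; <-≤-trans
        ; <⇒≱; ≰⇒>; +-monoʳ-<; *-monoʳ-<; +-monoʳ-≤; +-monoˡ-≤; module ≤-Reasoning )
open import Data.Nat.DivMod using (m%n%n≡m%n; m<n⇒m%n≡m; %-distribˡ-+; %-distribˡ-*; m*n%n≡0; m%n<n)
open import Data.Nat.Divisibility using (n∣m⇒m%n≡0)
open import Data.Nat.Primality using (Prime; prime⇒irreducible)
open import Data.Nat.Coprimality using (Coprime; coprime-Bézout)
open import Data.Nat.GCD using (module Bézout)
open import Data.Nat.Tactic.RingSolver using (solve-∀)
open import Algebra.Properties.CommutativeSemigroup +-commutativeSemigroup using (x∙yz≈y∙xz)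
open import Data.Fin using (Fin; zero; suc; toℕ; fromℕ<; combine; punchIn; _≟_)
open import Data.Fin.Properties
  using ( toℕ-injective; toℕ<n; toℕ-fromℕ<; *↔×; +↔⊎; combine-injective; punchIn-injective; punchInᵢ≢i
        ; injective⇒≤ )
open import Data.List using (List; map; allFin; take; length)
open import Data.List.Properties using (length-map; length-tabulate; length-take)
open import Data.List.Membership.Propositional using (_∈_)
open import Data.List.Membership.Propositional.Properties using (∈-map⁻)
open import Data.List.Relation.Unary.Unique.Propositional using (Unique)
open import Data.List.Relation.Unary.Unique.Propositional.Properties using (map⁺; allFin⁺; take⁺)
import Data.List.Relation.Binary.Sublist.Propositional as Sublist
open import Data.List.Relation.Binary.Sublist.Propositional.Properties using (take-⊆)
open import Data.Empty using (⊥-elim)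
open import Data.Product using (∃-syntax; Σ-syntax; _×_; _,_; proj₁; proj₂; uncurry; map₁)
open import Data.Sum using (_⊎_; inj₁; inj₂)
open import Data.Sum.Function.Propositional using (_⊎-↔_)
import Data.Integer as ℤ
import Data.Integer.Properties as ℤ
import Data.Integer.Tactic.RingSolver as ℤSolver
open import Function using (_∘_)
open import Function.Bundles using (Inverse; Injection; _↣_)
open import Function.Properties.Inverse using (↔⇒↣; ↔-sym; ↔-trans)
open import Relation.Nullary using (¬_; contradiction; yes; no)
open import Relation.Binary.Bundles using (Setoid)
open import Relation.Binary.PropositionalEquality
import Relation.Binary.Construct.On as On
import Relation.Binary.Reasoning.Setoid as SetoidReasoning

open import Defs

module Congruence (n : ℕ) .{{_ : NonZero n}} where

  infix 4 _≈_
  _≈_ : ℕ → ℕ → Set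
  a ≈ b = a % n ≡ b % n

  ≈-setoid : Setoid _ _
  ≈-setoid = On.setoid (setoid ℕ) (_% n)

  open Setoid ≈-setoid public using () renaming (refl to ≈-refl; sym to ≈-sym; trans to ≈-trans)
  module ≈-Reasoning = SetoidReasoning ≈-setoid

  ≡⇒≈ : ∀ {a b} → a ≡ b → a ≈ b
  ≡⇒≈ = cong (_% n)

  m%n≈m : ∀ a → a % n ≈ a
  m%n≈m a = m%n%n≡m%n a n

  ≈⇒≡ : ∀ {a b} → a < n → b < n → a ≈ b → a ≡ b
  ≈⇒≡ {a} {b} a<n b<n a≈b = trans (sym (m<n⇒m%n≡m a<n)) (trans a≈b (m<n⇒m%n≡m b<n))

  +-cong : ∀ {a b c d} → a ≈ b → c ≈ d → a + c ≈ b + d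
  +-cong {a} {b} {c} {d} a≈b c≈d = trans (%-distribˡ-+ a c n)
    (trans (cong₂ (λ x y → (x + y) % n) a≈b c≈d) (sym (%-distribˡ-+ b d n)))

  *-cong : ∀ {a b c d} → a ≈ b → c ≈ d → a * c ≈ b * d
  *-cong {a} {b} {c} {d} a≈b c≈d = trans (%-distribˡ-* a c n)
    (trans (cong₂ (λ x y → (x * y) % n) a≈b c≈d) (sym (%-distribˡ-* b d n)))

  0%n≡0 : 0 % n ≡ 0
  0%n≡0 = m<n⇒m%n≡m (>-nonZero⁻¹ n)

  m*n≈0 : ∀ k → k * n ≈ 0
  m*n≈0 k = trans (m*n%n≡0 k n) (sym 0%n≡0)

  -- Additive inverse modulo n, avoiding truncated subtraction.
  -_ : ℕ → ℕ
  - a = pred n * a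

  infixl 6 _−_
  _−_ : ℕ → ℕ → ℕ
  a − b = a + - b

  +-inverseʳ : ∀ a → a + - a ≈ 0
  +-inverseʳ a = begin
    a + - a         ≡⟨⟩
    suc (pred n) * a ≡⟨ cong (_* a) (suc-pred n) ⟩
    n * a           ≡⟨ *-comm n a ⟩
    a * n           ≈⟨ m*n≈0 a ⟩
    0               ∎
    where open ≈-Reasoning

  +-cancelʳ : ∀ {a b} c → a + c ≈ b + c → a ≈ b
  +-cancelʳ {a} {b} c a+c≈b+c = begin
    a               ≡⟨ +-identityʳ a ⟨
    a + 0           ≈⟨ +-cong (≈-refl {a}) (+-inverseʳ c) ⟨
    a + (c + - c)   ≡⟨ +-assoc a c (- c) ⟨
    a + c + - c     ≈⟨ +-cong a+c≈b+c (≈-refl { - c}) ⟩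
    b + c + - c     ≡⟨ +-assoc b c (- c) ⟩
    b + (c + - c)   ≈⟨ +-cong (≈-refl {b}) (+-inverseʳ c) ⟩
    b + 0           ≡⟨ +-identityʳ b ⟩
    b               ∎
    where open ≈-Reasoning

  m+[n−m]≈n : ∀ m n → m + (n − m) ≈ n
  m+[n−m]≈n m n = begin
    m + (n + - m)   ≡⟨ x∙yz≈y∙xz m n (- m) ⟩
    n + (m + - m)   ≈⟨ +-cong (≈-refl {n}) (+-inverseʳ m) ⟩
    n + 0           ≡⟨ +-identityʳ n ⟩
    n               ∎
    where open ≈-Reasoning

  prime⇒invertible : Prime n → ∀ {d} → ¬ d ≈ 0 → ∃[ y ] y * d ≈ 1
  prime⇒invertible p {d} d≉0 with coprime-Bézout coprime
    where
    coprime : Coprime d n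
    coprime (c∣d , c∣n) with prime⇒irreducible p c∣n
    ... | inj₁ c≡1 = c≡1
    ... | inj₂ refl = contradiction (trans (n∣m⇒m%n≡0 d n c∣d) (sym (0%n≡0))) d≉0
  ... | Bézout.+- x y 1+yn≡xd = x , (begin
    x * d           ≡⟨ 1+yn≡xd ⟨
    1 + y * n       ≈⟨ +-cong (≈-refl {1}) (m*n≈0 y) ⟩
    1 + 0           ∎)
    where open ≈-Reasoning
  ... | Bézout.-+ x y 1+xd≡yn = - x , (begin
    - x * d                   ≈⟨ +-cong 1+xd≈0 (≈-refl { - x * d}) ⟨
    1 + x * d + - x * d       ≡⟨ +-assoc 1 (x * d) (- x * d) ⟩
    1 + (x * d + - x * d)     ≡⟨ cong (1 +_) (*-distribʳ-+ d x (- x)) ⟨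
    1 + (x + - x) * d         ≈⟨ +-cong (≈-refl {1}) (*-cong (+-inverseʳ x) (≈-refl {d})) ⟩
    1 + 0 * d                 ≡⟨⟩
    1                         ∎)
    where
    open ≈-Reasoning
    1+xd≈0 : 1 + x * d ≈ 0
    1+xd≈0 = ≈-trans (≡⇒≈ 1+xd≡yn) (m*n≈0 y)

  nonzero-residue : ∀ {i} → ¬ i ≈ 0 → ∃[ t ] suc t < n × suc t ≈ i
  nonzero-residue {i} i≉0 with i % n in i%n≡
  ... | zero  = contradiction (sym 0%n≡0) i≉0
  ... | suc t = t , subst (_< n) i%n≡ (m%n<n i n) , trans (cong (_% n) (sym i%n≡)) (trans (m%n≈m i) i%n≡)

  ≉⇒−≉0 : ∀ {b c} → ¬ b ≈ c → ¬ b − c ≈ 0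
  ≉⇒−≉0 {b} {c} b≉c b−c≈0 = b≉c (begin
    b           ≈⟨ m+[n−m]≈n c b ⟨
    c + (b − c) ≈⟨ +-cong (≈-refl {c}) b−c≈0 ⟩
    c + 0       ≡⟨ +-identityʳ c ⟩
    c           ∎)
    where open ≈-Reasoning

  -- Take i ≈ (j − j′) / (a − a′) and x ≈ j − i a.
  ≈-line-through : Prime n → ∀ {a a′ j j′} → ¬ a ≈ a′ → ¬ j ≈ j′ →
            ∃[ i ] ∃[ x ] ¬ i ≈ 0 × x + i * a ≈ j × x + i * a′ ≈ j′
  ≈-line-through p {a} {a′} {j} {j′} a≉a′ j≉j′ with prime⇒invertible p (≉⇒−≉0 a≉a′)
  ... | y , yδ≈1 = i , x , i≉0 , x+ia≈j , x+ia′≈j′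
    where
    open ≈-Reasoning
    δ e i x : ℕ
    δ = a − a′
    e = j − j′
    i = y * e
    x = j − i * a

    iδ≈e : i * δ ≈ e
    iδ≈e = begin
      y * e * δ   ≡⟨ cong (_* δ) (*-comm y e) ⟩
      e * y * δ   ≡⟨ *-assoc e y δ ⟩
      e * (y * δ) ≈⟨ *-cong (≈-refl {e}) yδ≈1 ⟩
      e * 1       ≡⟨ *-identityʳ e ⟩
      e           ∎

    i≉0 : ¬ i ≈ 0
    i≉0 i≈0 = ≉⇒−≉0 j≉j′ (≈-trans (≈-sym iδ≈e) (*-cong i≈0 (≈-refl {δ})))

    x+ia≈j : x + i * a ≈ j
    x+ia≈j = ≈-trans (≡⇒≈ (+-comm x (i * a))) (m+[n−m]≈n (i * a) j)

    x+ia′≈j′ : x + i * a′ ≈ j′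
    x+ia′≈j′ = +-cancelʳ (i * δ) (begin
      x + i * a′ + i * δ   ≡⟨ +-assoc x (i * a′) (i * δ) ⟩
      x + (i * a′ + i * δ) ≡⟨ cong (x +_) (*-distribˡ-+ i a′ δ) ⟨
      x + i * (a′ + δ)     ≈⟨ +-cong (≈-refl {x}) (*-cong (≈-refl {i}) (m+[n−m]≈n a′ a)) ⟩
      x + i * a            ≈⟨ x+ia≈j ⟩
      j                    ≈⟨ m+[n−m]≈n j′ j ⟨
      j′ + e               ≈⟨ +-cong (≈-refl {j′}) iδ≈e ⟨
      j′ + i * δ           ∎)

module _ {A C : Set} {E : Graph A} {k : ℕ} where

  proper-↣⇒colorable : (c : A → C) → Proper E c → C ↣ Fin k → Colorable E k
  proper-↣⇒colorable c proper ι = Injection.to ι ∘ c , λ x y xy → proper x y xy ∘ Injection.injective ι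

module _ {A : Set} {E : Graph A} where

  Choosable-mono : ∀ {j k} → j ≤ k → Choosable E j → Choosable E k
  Choosable-mono {j} {k} j≤k choose lists length≡k unique
    with choose (take j ∘ lists) length≡j (take⁺ j ∘ unique)
    where
    length≡j : ∀ x → length (take j (lists x)) ≡ j
    length≡j x = trans (length-take j (lists x)) (trans (cong (j ⊓_) (length≡k x)) (m≤n⇒m⊓n≡m j≤k))
  ... | c , c∈ , proper = c , (λ x → Sublist.lookup (take-⊆ j (lists x)) (c∈ x)) , proper

bounded-injective⇒≤ : ∀ {m k} (f : Fin m → ℕ) → (∀ i → f i < k) → (∀ {i j} → f i ≡ f j → i ≡ j) → m ≤ k
bounded-injective⇒≤ f f<k f-injective = injective⇒≤ {f = λ i → fromℕ< (f<k i)} λ {i} {j} eq →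
  f-injective (trans (sym (toℕ-fromℕ< (f<k i))) (trans (cong toℕ eq) (toℕ-fromℕ< (f<k j))))

-- Colours < (1 + r) d, viewed as pairs (block, offset) with 1 + r blocks of size d.
module Blocks (r d : ℕ) where

  code : Fin (suc r) × Fin d → ℕ
  code = toℕ ∘ uncurry combine

  code-injective : ∀ {γ γ′} → code γ ≡ code γ′ → γ ≡ γ′
  code-injective {B , o} {B′ , o′} eq with combine-injective B o B′ o′ (toℕ-injective eq)
  ... | refl , refl = refl

  code< : ∀ γ → code γ < suc r * d
  code< γ = toℕ<n (uncurry combine γ)

  shift : Fin (suc r) → Fin r × Fin d → Fin (suc r) × Fin d
  shift J = map₁ (punchIn J)

  shift-injective : ∀ J {γ γ′} → shift J γ ≡ shift J γ′ → γ ≡ γ′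
  shift-injective J {b , _} {b′ , _} eq =
    cong₂ _,_ (punchIn-injective J b b′ (cong proj₁ eq)) (cong proj₂ eq)

  avoiding : Fin (suc r) → List ℕ
  avoiding J = map (code ∘ shift J ∘ Inverse.to *↔×) (allFin (r * d))

  length-avoiding : ∀ J → length (avoiding J) ≡ r * d
  length-avoiding J = trans (length-map _ (allFin (r * d))) (length-tabulate (λ t → t))

  avoiding-unique : ∀ J → Unique (avoiding J)
  avoiding-unique J =
    map⁺ (Injection.injective (↔⇒↣ *↔×) ∘ shift-injective J ∘ code-injective) (allFin⁺ (r * d))

  ∈-avoiding⁻ : ∀ {c} J → c ∈ avoiding J → ∃[ γ ] c ≡ code γ × proj₁ γ ≢ J
  ∈-avoiding⁻ J c∈ with ∈-map⁻ (code ∘ shift J ∘ Inverse.to *↔×) c∈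
  ... | t , _ , refl = _ , refl , punchInᵢ≢i J _

  ∈-avoiding⇒< : ∀ {c} J → c ∈ avoiding J → c < suc r * d
  ∈-avoiding⇒< J c∈ = let (γ , c≡γ , _) = ∈-avoiding⁻ J c∈ in subst (_< suc r * d) (sym c≡γ) (code< γ)

module _ {A : Set} (E : Graph A) {q r d : ℕ} where
  open Blocks r d

  -- Vertex x p J gets the colours outside block J.  If x p 0 receives a colour of block J,
  -- then x p J receives another one, so the q pairwise adjacent parts need 2q colours.
  multipartite-¬Choosable :
    (excluded : A → Fin (suc r)) (x : Fin q → Fin (suc r) → A) →
    (∀ p J → excluded (x p J) ≡ J) →
    (∀ {p p′} J J′ → p ≢ p′ → E (x p J) (x p′ J′)) →
    suc r * d < q * 2 → ¬ Choosable E (r * d)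
  multipartite-¬Choosable excluded x excluded-x adjacent palette<2q choose
    with choose (avoiding ∘ excluded) (length-avoiding ∘ excluded) (avoiding-unique ∘ excluded)
  ... | c , c∈ , proper = <⇒≱ palette<2q (bounded-injective⇒≤ (c ∘ pick ∘ Inverse.to *↔×)
                            (pick-colour< ∘ Inverse.to *↔×)
                            (Injection.injective (↔⇒↣ *↔×) ∘ pick-injective))
    where
    c∈avoiding : ∀ p J → c (x p J) ∈ avoiding J
    c∈avoiding p J = subst (λ K → c (x p J) ∈ avoiding K) (excluded-x p J) (c∈ (x p J))

    block : Fin q → Fin (suc r)
    block p = proj₁ (proj₁ (∈-avoiding⁻ zero (c∈avoiding p zero)))

    two-colours : ∀ p → c (x p zero) ≢ c (x p (block p))
    two-colours p eq =
      let (γ , c≡γ , _) = ∈-avoiding⁻ zero (c∈avoiding p zero)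
          (γ′ , c≡γ′ , γ′∉block) = ∈-avoiding⁻ (block p) (c∈avoiding p (block p))
      in γ′∉block (cong proj₁ (code-injective (trans (sym c≡γ′) (trans (sym eq) c≡γ))))

    level : Fin q → Fin 2 → Fin (suc r)
    level p zero    = zero
    level p (suc _) = block p

    pick : Fin q × Fin 2 → A
    pick (p , β) = x p (level p β)

    pick-colour< : ∀ π → c (pick π) < suc r * d
    pick-colour< (p , β) = ∈-avoiding⇒< (level p β) (c∈avoiding p (level p β))

    pick-injective : ∀ {π π′} → c (pick π) ≡ c (pick π′) → π ≡ π′
    pick-injective {p , β} {p′ , β′} eq with p ≟ p′
    ... | no p≢p′ = ⊥-elim (proper _ _ (adjacent (level p β) (level p′ β′) p≢p′) eq)
    pick-injective {p , zero}     {_ , zero}     eq | yes refl = refl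
    pick-injective {p , suc zero} {_ , suc zero} eq | yes refl = refl
    pick-injective {p , zero}     {_ , suc zero} eq | yes refl = ⊥-elim (two-colours p eq)
    pick-injective {p , suc zero} {_ , zero}     eq | yes refl = ⊥-elim (two-colours p (sym eq))

module _ {n : ℕ} .{{_ : NonZero n}} where
  open Congruence n

  toℕ-≈-injective : ∀ {a b : Fin n} → toℕ a ≈ toℕ b → a ≡ b
  toℕ-≈-injective {a} {b} a≈b = toℕ-injective (≈⇒≡ (toℕ<n a) (toℕ<n b) a≈b)

  L0-injective : ∀ i {j j′} k → L0 n i j k ≡ L0 n i j′ k → j ≡ j′
  L0-injective i k eq = toℕ-≈-injective (+-cancelʳ (suc (toℕ i) * toℕ k) eq)

  L0-from-≈ : ∀ {i₀ x₀} (i : Fin (n ∸ 1)) (x : Fin n) → suc (toℕ i) ≈ i₀ → toℕ x ≈ x₀ →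
              ∀ b k → x₀ + i₀ * toℕ b ≈ toℕ k → toℕ k ≡ L0 n i x b
  L0-from-≈ {i₀} {x₀} i x i≈i₀ x≈x₀ b k x₀+i₀b≈k = begin
    toℕ k                                 ≡⟨ m<n⇒m%n≡m (toℕ<n k) ⟨
    toℕ k % n                             ≡⟨ x₀+i₀b≈k ⟨
    (x₀ + i₀ * toℕ b) % n                 ≡⟨ +-cong x≈x₀ (*-cong i≈i₀ (≈-refl {toℕ b})) ⟨
    (toℕ x + suc (toℕ i) * toℕ b) % n     ∎
    where open ≡-Reasoning

  L0-line-from-≈ : ∀ {i₀ x₀} → ¬ i₀ ≈ 0 → ∀ {a a′ j j′ : Fin n} →
                   x₀ + i₀ * toℕ a ≈ toℕ j → x₀ + i₀ * toℕ a′ ≈ toℕ j′ →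
                   Σ[ i ∈ Fin (n ∸ 1) ] Σ[ x ∈ Fin n ] toℕ j ≡ L0 n i x a × toℕ j′ ≡ L0 n i x a′
  L0-line-from-≈ {i₀} {x₀} i₀≉0 {a} {a′} {j} {j′} on-j on-j′ =
    i , x , L0-from-≈ i x i≈i₀ x≈x₀ a j on-j , L0-from-≈ i x i≈i₀ x≈x₀ a′ j′ on-j′
    where
    t : ℕ
    t = proj₁ (nonzero-residue i₀≉0)
    t<n∸1 : t < n ∸ 1
    t<n∸1 = ∸-monoˡ-< (proj₁ (proj₂ (nonzero-residue i₀≉0))) (s≤s z≤n)
    i : Fin (n ∸ 1)
    i = fromℕ< t<n∸1
    x : Fin n
    x = fromℕ< (m%n<n x₀ n)
    i≈i₀ : suc (toℕ i) ≈ i₀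
    i≈i₀ = ≈-trans (≡⇒≈ (cong suc (toℕ-fromℕ< t<n∸1))) (proj₂ (proj₂ (nonzero-residue i₀≉0)))
    x≈x₀ : toℕ x ≈ x₀
    x≈x₀ = ≈-trans (≡⇒≈ (toℕ-fromℕ< (m%n<n x₀ n))) (m%n≈m x₀)

  L0-line-through : Prime n → ∀ {a a′ j j′ : Fin n} → a ≢ a′ → j ≢ j′ →
                    Σ[ i ∈ Fin (n ∸ 1) ] Σ[ x ∈ Fin n ] toℕ j ≡ L0 n i x a × toℕ j′ ≡ L0 n i x a′
  L0-line-through p {a} {a′} {j} {j′} a≢a′ j≢j′ =
    let (_ , _ , i₀≉0 , on-j , on-j′) = ≈-line-through p {toℕ a} {toℕ a′} {toℕ j} {toℕ j′}
                                          (a≢a′ ∘ toℕ-≈-injective) (j≢j′ ∘ toℕ-≈-injective)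
    in L0-line-from-≈ i₀≉0 on-j on-j′

  edge-target-is-sink : ∀ {x y z} → Edge n x y → ¬ Edge n y z
  edge-target-is-sink (ew _ _ _ _ _ _) ()
  edge-target-is-sink (eu _ _ _ _ _ _) ()
  edge-target-is-sink (es _ _ _)       ()

  -- s_m shares the palette of the w's as an extra class i = 0: its neighbourhood is the one
  -- w_{0,m} would have, as L_0(m, k) = m.
  Colour : Set
  Colour = (Fin n × Fin n) ⊎ (Fin (suc (n ∸ 1)) ⊎ Fin (n ∸ 1))

  colour : V n → Colour
  colour (v l k _) = inj₁ (l , k)
  colour (s _)     = inj₂ (inj₁ zero)
  colour (w i _)   = inj₂ (inj₁ (suc i))
  colour (u i _)   = inj₂ (inj₂ i)

  colour-separates-edge : ∀ {x y} → Edge n x y → colour x ≢ colour y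
  colour-separates-edge (ew _ _ _ _ _ _) ()
  colour-separates-edge (eu _ _ _ _ _ _) ()
  colour-separates-edge (es _ _ _)       ()

  colour-injective-around-v : ∀ {x y z} → Edge n x z → Edge n y z → colour x ≡ colour y → x ≡ y
  colour-injective-around-v (ew i _ _ k _ p) (ew _ _ _ _ _ p′) refl =
    cong (w i) (L0-injective i k (trans (sym p) p′))
  colour-injective-around-v (eu i _ l _ _ p) (eu _ _ _ _ _ p′) refl =
    cong (u i) (L0-injective i l (trans (sym p) p′))
  colour-injective-around-v (es _ _ _) (es _ _ _) refl = refl

  colour-injective-around-hub : ∀ {x y z} → Edge n z x → Edge n z y → colour x ≡ colour y → x ≡ y
  colour-injective-around-hub (ew _ _ _ _ _ p) (ew _ _ _ _ _ p′) refl = cong (v _ _) (toℕ-injective (trans p (sym p′)))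
  colour-injective-around-hub (eu _ _ _ _ _ p) (eu _ _ _ _ _ p′) refl = cong (v _ _) (toℕ-injective (trans p (sym p′)))
  colour-injective-around-hub (es _ _ _)       (es _ _ _)        refl = refl

  colour-proper : Proper (Square (G n)) colour
  colour-proper _ _ (_ , inj₁ (inj₁ e)) = colour-separates-edge e
  colour-proper _ _ (_ , inj₁ (inj₂ e)) = colour-separates-edge e ∘ sym
  colour-proper _ _ (x≢y , inj₂ (_ , inj₁ e , inj₂ e′)) = x≢y ∘ colour-injective-around-v e e′
  colour-proper _ _ (x≢y , inj₂ (_ , inj₂ e , inj₁ e′)) = x≢y ∘ colour-injective-around-hub e e′
  colour-proper _ _ (_ , inj₂ (_ , inj₁ e , inj₁ e′)) = ⊥-elim (edge-target-is-sink e e′)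
  colour-proper _ _ (_ , inj₂ (_ , inj₂ e , inj₂ e′)) = ⊥-elim (edge-target-is-sink e′ e)

  side : V n → Fin 2
  side (v _ _ _) = zero
  side _         = suc zero

  side-separates-edge : ∀ {x y} → Edge n x y → side x ≢ side y
  side-separates-edge (ew _ _ _ _ _ _) ()
  side-separates-edge (eu _ _ _ _ _ _) ()
  side-separates-edge (es _ _ _)       ()

  G-bipartite : Bipartite (G n)
  G-bipartite = side , λ { _ _ (inj₁ e) → side-separates-edge e
                         ; _ _ (inj₂ e) → side-separates-edge e ∘ sym }

  G²-colorable : Colorable (Square (G n)) (n * n + (suc (n ∸ 1) + (n ∸ 1)))
  G²-colorable = proper-↣⇒colorable colour colour-proper (↔⇒↣ (↔-sym (↔-trans +↔⊎ (*↔× ⊎-↔ +↔⊎))))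

  v-adjacent-in-G² : Prime n → ∀ {l k l′ k′} j j′ → (l , k) ≢ (l′ , k′) → Square (G n) (v l k j) (v l′ k′ j′)
  v-adjacent-in-G² p {l} {k} {l′} {k′} j j′ lk≢l′k′ = distinct , inj₂ common-neighbour
    where
    distinct : v l k j ≢ v l′ k′ j′
    distinct refl = lk≢l′k′ refl
    through : ∀ {z} → Edge n z (v l k j) → Edge n z (v l′ k′ j′) →
              Σ[ z′ ∈ V n ] G n (v l k j) z′ × G n z′ (v l′ k′ j′)
    through e e′ = _ , inj₂ e , inj₁ e′
    common-neighbour : Σ[ z ∈ V n ] G n (v l k j) z × G n z (v l′ k′ j′)
    common-neighbour with j ≟ j′ | k ≟ k′
    ... | yes refl | _ = through (es j l k) (es j l′ k′)
    ... | no j≢j′ | no k≢k′ =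
      let (i , x , e , e′) = L0-line-through p k≢k′ j≢j′
      in through (ew i x l k j e) (ew i x l′ k′ j′ e′)
    ... | no j≢j′ | yes refl =
      let (i , x , e , e′) = L0-line-through p (lk≢l′k′ ∘ cong (_, k)) j≢j′
      in through (eu i x l k j e) (eu i x l′ k j′ e′)

  excluded : V n → Fin n
  excluded (v _ _ j) = j
  excluded (w _ j)   = j
  excluded (u _ j)   = j
  excluded (s m)     = m

G²-¬Choosable : ∀ {n′} → Prime (suc n′) → ¬ Choosable (Square (G (suc n′))) (n′ * (suc n′ + n′))
G²-¬Choosable {n′} p = multipartite-¬Choosable (Square (G (suc n′))) excluded column (λ _ _ → refl)
  (λ J J′ p≢p′ → v-adjacent-in-G² p J J′ (p≢p′ ∘ Injection.injective (↔⇒↣ *↔×)))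
  (<-≤-trans (*-monoʳ-< (suc n′) (+-monoʳ-< (suc n′) (n<1+n n′))) (≤-reflexive (square-double (suc n′))))
  where
  column : Fin (suc n′ * suc n′) → Fin (suc n′) → V (suc n′)
  column p = uncurry v (Inverse.to *↔× p)
  square-double : ∀ m → m * (m + m) ≡ m * m * 2
  square-double = solve-∀

-- Opened only here, since +_ makes sections such as (x +_) above ambiguous.
open import Data.Integer using (+_; _-_)

ℕ-<⇒ℤ : ∀ A B C D E → A + C + E < D + B → (+ A - + B) ℤ.+ + C ℤ.< + D - + E
ℕ-<⇒ℤ A B C D E lt = subst₂ ℤ._<_ lhs rhs (ℤ.+-monoˡ-< (ℤ.- + B ℤ.+ ℤ.- + E) (ℤ.+<+ lt))
  where
  lhs : + (A + C + E) ℤ.+ (ℤ.- + B ℤ.+ ℤ.- + E) ≡ + A - + B ℤ.+ + C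
  lhs rewrite ℤ.pos-+ (A + C) E | ℤ.pos-+ A C = ring (+ A) (+ B) (+ C) (+ E)
    where
    ring : ∀ a b c e → a ℤ.+ c ℤ.+ e ℤ.+ (ℤ.- b ℤ.+ ℤ.- e) ≡ a - b ℤ.+ c
    ring = ℤSolver.solve-∀
  rhs : + (D + B) ℤ.+ (ℤ.- + B ℤ.+ ℤ.- + E) ≡ + D - + E
  rhs rewrite ℤ.pos-+ D B = ring (+ D) (+ B) (+ E)
    where
    ring : ∀ d b e → d ℤ.+ b ℤ.+ (ℤ.- b ℤ.+ ℤ.- e) ≡ d - e
    ring = ℤSolver.solve-∀

colour-bounds⇒gap : ∀ n′ {a b} → a ≤ suc n′ * suc n′ + (suc n′ + n′) → n′ * (suc n′ + n′) < b →
                    suc n′ * suc n′ + 3 + a < b + 6 * suc n′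
colour-bounds⇒gap n′ {a} {b} a≤K N<b = begin-strict
  n * n + 3 + a                               ≤⟨ +-monoʳ-≤ (n * n + 3) a≤K ⟩
  n * n + 3 + (n * n + (n + n′))              <⟨ s≤s (m≤m+n _ n′) ⟩
  suc (n * n + 3 + (n * n + (n + n′)) + n′)   ≡⟨ count n′ ⟩
  suc (n′ * (n + n′)) + 6 * n                 ≤⟨ +-monoˡ-≤ (6 * n) N<b ⟩
  b + 6 * n                                   ∎
  where
  open ≤-Reasoning
  n = suc n′
  count : ∀ m → suc (suc m * suc m + 3 + (suc m * suc m + (suc m + m)) + m)
              ≡ suc (m * (suc m + m)) + 6 * suc m
  count = solve-∀

theorem2p8 : (n : ℕ) .{{_ : NonZero n}} → Prime n → 3 ≤ n →
    Bipartite (G n) ×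
    (∀ a b → IsChromaticNumber (Square (G n)) a → IsChoiceNumber (Square (G n)) b →
    ((+ (n * n)) - (+ (6 * n))) ℤ.+ (+ 3) ℤ.< (+ b) - (+ a))
theorem2p8 n@(suc n′) p _ = G-bipartite , λ a b (_ , χ-least) (b-choosable , _) →
  ℕ-<⇒ℤ (n * n) (6 * n) 3 b a (colour-bounds⇒gap n′
    (χ-least _ G²-colorable)
    (≰⇒> (λ b≤N → G²-¬Choosable p (Choosable-mono b≤N b-choosable))))
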